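{- For all implicative-disjunctive formulas $A, B$ and every truth value assignment $V$: $$(\Delta[V;B])^{B} \vdash_{id} (\Delta[V;A \to B])^{A \to B}.$$
   Context: **Language.** Formulas are built from the atomic formulas $p_1, p_2, \dots$ using the binary connectives $\to$, $\vee$ and $\&$. Implicative-disjunctive formulas are those without $\&$. Iterated connectives associate to the right. All formulas are arranged in a fixed decidable linear order $R$. **Semantics.** A truth value assignment $V$ maps formulas to $\{T,F\}$ according to the classical truth conditions. **Notation.** - $\Delta[V;A]$ is the set of atomic subformulas $C$ of $A$ with $V(C)=F$. - For a finite set $K$ of formulas with distinct elements $B_1, \dots, B_n$ listed in the order $R$, $(K)^{A}$ is $A$ if $K$ is empty, and $B_1 \vee \dots \vee B_n \vee A$ (that is, $B_1 \vee (\dots \vee (B_n \vee A))$) otherwise. **Calculus.** $\vdash_{id}$ denotes derivability in the classical implicative-disjunctive propositional calculus. Its axiom schemes are: - $A \to B \to A$; - $(A \to B \to C) \to (A \to B) \to A \to C$; - $((A \to B) \to A) \to A$; - $A \to (A \vee B)$; - $A \to (B \vee A)$; - $(A \to C) \to (B \to C) \to (A \vee B) \to C$. Its only rule is modus ponens. -}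

module Defs where

open import Data.Nat using (ℕ)
open import Data.Product using (Σ; _,_)
open import Data.Bool using (Bool; true; false; not; _∧_; _∨_)
open import Data.List using (List; []; _∷_; _++_)
open import Relation.Binary.PropositionalEquality using (_≡_)
open import Relation.Binary.Structures using (IsStrictTotalOrder)
open import Relation.Binary.Definitions using (tri<; tri≈; tri>)
open import Level using (0ℓ)
open import Data.List.Membership.Propositional using (_∈_)
open import Relation.Nullary using (Dec; yes; no)

infixr 6 _⇒_
infixr 7 _∨'_
infixr 8 _&_

data Formula : Set where
  p    : ℕ → Formula
  _⇒_  : Formula → Formula → Formula
  _∨'_ : Formula → Formula → Formula
  _&_  : Formula → Formula → Formula

data IsID : Formula → Set where
  atomID : ∀ n → IsID (p n)
  impID  : ∀ {A B} → IsID A → IsID B → IsID (A ⇒ B)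
  orID   : ∀ {A B} → IsID A → IsID B → IsID (A ∨' B)

Assignment : Set
Assignment = ℕ → Bool

⟦_⟧ : Formula → Assignment → Bool
⟦ p n ⟧ V = V n
⟦ A ⇒ B ⟧ V = not (⟦ A ⟧ V) ∨ ⟦ B ⟧ V
⟦ A ∨' B ⟧ V = ⟦ A ⟧ V ∨ ⟦ B ⟧ V
⟦ A & B ⟧ V = ⟦ A ⟧ V ∧ ⟦ B ⟧ V

data _⊢id_ (Γ : List Formula) : Formula → Set where
  hyp : ∀ {A} → A ∈ Γ → Γ ⊢id A
  ax1 : ∀ {A B} → IsID A → IsID B → Γ ⊢id (A ⇒ B ⇒ A)
  ax2 : ∀ {A B C} → IsID A → IsID B → IsID C →
        Γ ⊢id ((A ⇒ B ⇒ C) ⇒ (A ⇒ B) ⇒ A ⇒ C)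
  ax3 : ∀ {A B} → IsID A → IsID B → Γ ⊢id (((A ⇒ B) ⇒ A) ⇒ A)
  ax4 : ∀ {A B} → IsID A → IsID B → Γ ⊢id (A ⇒ (A ∨' B))
  ax5 : ∀ {A B} → IsID A → IsID B → Γ ⊢id (A ⇒ (B ∨' A))
  ax6 : ∀ {A B C} → IsID A → IsID B → IsID C →
        Γ ⊢id ((A ⇒ C) ⇒ (B ⇒ C) ⇒ (A ∨' B) ⇒ C)
  mp  : ∀ {A B} → Γ ⊢id A → Γ ⊢id (A ⇒ B) → Γ ⊢id B

-- A fixed decidable linear order R on formulas: a strict total order w.r.t. ≡
-- (strict total orders in agda-stdlib come with a trichotomy decision procedure).
record FormulaOrder : Set₁ where
  field
    _<R_ : Formula → Formula → Set
    isSTO : IsStrictTotalOrder _≡_ _<R_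

module WithOrder (R : FormulaOrder) where
  open FormulaOrder R
  open IsStrictTotalOrder isSTO using (compare)

  insert : Formula → List Formula → List Formula
  insert x [] = x ∷ []
  insert x (y ∷ ys) with compare x y
  ... | tri< _ _ _ = x ∷ y ∷ ys
  ... | tri≈ _ _ _ = y ∷ ys
  ... | tri> _ _ _ = y ∷ insert x ys

  -- the finite set of formulas given by a list, as its distinct elements in order R
  sorted : List Formula → List Formula
  sorted [] = []
  sorted (x ∷ xs) = insert x (sorted xs)

  falseAtoms : Assignment → Formula → List Formula
  falseAtoms V (p n) with V n
  ... | true  = []
  ... | false = p n ∷ []
  falseAtoms V (A ⇒ B) = falseAtoms V A ++ falseAtoms V B
  falseAtoms V (A ∨' B) = falseAtoms V A ++ falseAtoms V B
  falseAtoms V (A & B) = falseAtoms V A ++ falseAtoms V B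

  Δ : Assignment → Formula → List Formula
  Δ V A = sorted (falseAtoms V A)

  disjPrefix : List Formula → Formula → Formula
  disjPrefix [] A = A
  disjPrefix (B ∷ Bs) A = B ∨' disjPrefix Bs A

  _^⟨_⟩ : List Formula → Formula → Formula
  K ^⟨ A ⟩ = disjPrefix K A

-- Every atom of Δ[V;B] also occurs in Δ[V;A → B], and B ⊢ A → B; so each
-- disjunct of (Δ[V;B])^B implies (Δ[V;A → B])^(A → B), and ∨-elimination
-- assembles these implications.
module Submission where

open import Defs
open import Data.Bool using (true; false)
open import Data.List using (List; []; _∷_; _++_)
open import Data.List.Membership.Propositional using (_∈_)
open import Data.List.Relation.Binary.Subset.Propositional using (_⊆_)
open import Data.List.Relation.Binary.Subset.Propositional.Properties
  using (xs⊆ys++xs; ⊆-trans)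
open import Data.List.Relation.Unary.All using (All; []; _∷_; lookup)
open import Data.List.Relation.Unary.All.Properties using (++⁺; anti-mono)
open import Data.List.Relation.Unary.Any using (here; there)
open import Data.Sum using (_⊎_; inj₁; inj₂)
open import Relation.Binary.PropositionalEquality using (_≡_; refl)
open import Relation.Binary.Structures using (IsStrictTotalOrder)
open import Relation.Binary.Definitions using (tri<; tri≈; tri>)

module DerivedRules {Γ : List Formula} where

  ⊢-refl : ∀ {A} → IsID A → Γ ⊢id (A ⇒ A)
  ⊢-refl a = mp (ax1 a a) (mp (ax1 a (impID a a)) (ax2 a (impID a a) a))

  ⊢-trans : ∀ {A B C} → IsID A → IsID B → IsID C →
            Γ ⊢id (A ⇒ B) → Γ ⊢id (B ⇒ C) → Γ ⊢id (A ⇒ C)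
  ⊢-trans a b c ⊢ab ⊢bc = mp ⊢ab (mp (mp ⊢bc (ax1 (impID b c) a)) (ax2 a b c))

  ∨-elim : ∀ {A B C} → IsID A → IsID B → IsID C →
           Γ ⊢id (A ⇒ C) → Γ ⊢id (B ⇒ C) → Γ ⊢id (A ∨' B ⇒ C)
  ∨-elim a b c ⊢ac ⊢bc = mp ⊢bc (mp ⊢ac (ax6 a b c))

module DisjPrefix (R : FormulaOrder) {Γ : List Formula} where
  open WithOrder R using (disjPrefix)
  open DerivedRules {Γ}

  disjPrefix-ID : ∀ {K C} → All IsID K → IsID C → IsID (disjPrefix K C)
  disjPrefix-ID []       c = c
  disjPrefix-ID (x ∷ ks) c = orID x (disjPrefix-ID ks c)

  ⊢⇒disjPrefix-tail : ∀ {K C} → All IsID K → IsID C → Γ ⊢id (C ⇒ disjPrefix K C)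
  ⊢⇒disjPrefix-tail []       c = ⊢-refl c
  ⊢⇒disjPrefix-tail (x ∷ ks) c =
    ⊢-trans c (disjPrefix-ID ks c) (disjPrefix-ID (x ∷ ks) c)
      (⊢⇒disjPrefix-tail ks c) (ax5 (disjPrefix-ID ks c) x)

  ∈⇒⊢⇒disjPrefix : ∀ {x K C} → All IsID K → IsID C → x ∈ K →
                   Γ ⊢id (x ⇒ disjPrefix K C)
  ∈⇒⊢⇒disjPrefix (x ∷ ks) c (here refl) = ax4 x (disjPrefix-ID ks c)
  ∈⇒⊢⇒disjPrefix (y ∷ ks) c (there x∈K) =
    ⊢-trans (lookup ks x∈K) (disjPrefix-ID ks c) (disjPrefix-ID (y ∷ ks) c)
      (∈⇒⊢⇒disjPrefix ks c x∈K) (ax5 (disjPrefix-ID ks c) y)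

  disjPrefix-mono : ∀ {K L C D} → K ⊆ L → All IsID L → IsID C → IsID D →
                    Γ ⊢id (C ⇒ D) → Γ ⊢id (disjPrefix K C ⇒ disjPrefix L D)
  disjPrefix-mono {[]} _ ls c d ⊢cd =
    ⊢-trans c d (disjPrefix-ID ls d) ⊢cd (⊢⇒disjPrefix-tail ls d)
  disjPrefix-mono {x ∷ K} K⊆L ls c d ⊢cd =
    ∨-elim (lookup ls (K⊆L (here refl))) (disjPrefix-ID (anti-mono K⊆L′ ls) c)
      (disjPrefix-ID ls d)
      (∈⇒⊢⇒disjPrefix ls d (K⊆L (here refl)))
      (disjPrefix-mono K⊆L′ ls c d ⊢cd)
    where
    K⊆L′ : K ⊆ _
    K⊆L′ x∈K = K⊆L (there x∈K)

module SortedSets (R : FormulaOrder) where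
  open FormulaOrder R
  open IsStrictTotalOrder isSTO using (compare)
  open WithOrder R

  ∈-insert⁻ : ∀ {z} x ys → z ∈ insert x ys → z ≡ x ⊎ z ∈ ys
  ∈-insert⁻ x [] (here z≡x) = inj₁ z≡x
  ∈-insert⁻ x (y ∷ ys) z∈ with compare x y
  ∈-insert⁻ x (y ∷ ys) (here z≡x)  | tri< _ _ _ = inj₁ z≡x
  ∈-insert⁻ x (y ∷ ys) (there z∈)  | tri< _ _ _ = inj₂ z∈
  ∈-insert⁻ x (y ∷ ys) z∈          | tri≈ _ _ _ = inj₂ z∈
  ∈-insert⁻ x (y ∷ ys) (here z≡y)  | tri> _ _ _ = inj₂ (here z≡y)
  ∈-insert⁻ x (y ∷ ys) (there z∈)  | tri> _ _ _ with ∈-insert⁻ x ys z∈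
  ... | inj₁ z≡x  = inj₁ z≡x
  ... | inj₂ z∈ys = inj₂ (there z∈ys)

  ∈-insert⁺ˡ : ∀ x ys → x ∈ insert x ys
  ∈-insert⁺ˡ x [] = here refl
  ∈-insert⁺ˡ x (y ∷ ys) with compare x y
  ... | tri< _ _   _ = here refl
  ... | tri≈ _ x≡y _ = here x≡y
  ... | tri> _ _   _ = there (∈-insert⁺ˡ x ys)

  ∈-insert⁺ʳ : ∀ x ys → ys ⊆ insert x ys
  ∈-insert⁺ʳ x (y ∷ ys) z∈ with compare x y
  ∈-insert⁺ʳ x (y ∷ ys) z∈         | tri< _ _ _ = there z∈
  ∈-insert⁺ʳ x (y ∷ ys) z∈         | tri≈ _ _ _ = z∈
  ∈-insert⁺ʳ x (y ∷ ys) (here z≡y) | tri> _ _ _ = here z≡y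
  ∈-insert⁺ʳ x (y ∷ ys) (there z∈) | tri> _ _ _ = there (∈-insert⁺ʳ x ys z∈)

  sorted⊆ : ∀ xs → sorted xs ⊆ xs
  sorted⊆ (x ∷ xs) z∈ with ∈-insert⁻ x (sorted xs) z∈
  ... | inj₁ refl  = here refl
  ... | inj₂ z∈xs′ = there (sorted⊆ xs z∈xs′)

  ⊆sorted : ∀ xs → xs ⊆ sorted xs
  ⊆sorted (x ∷ xs) (here refl) = ∈-insert⁺ˡ x (sorted xs)
  ⊆sorted (x ∷ xs) (there z∈)  = ∈-insert⁺ʳ x (sorted xs) (⊆sorted xs z∈)

  falseAtoms-ID : ∀ V A → All IsID (falseAtoms V A)
  falseAtoms-ID V (p n) with V n
  ... | true  = []
  ... | false = atomID n ∷ []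
  falseAtoms-ID V (A ⇒ B)  = ++⁺ (falseAtoms-ID V A) (falseAtoms-ID V B)
  falseAtoms-ID V (A ∨' B) = ++⁺ (falseAtoms-ID V A) (falseAtoms-ID V B)
  falseAtoms-ID V (A & B)  = ++⁺ (falseAtoms-ID V A) (falseAtoms-ID V B)

  Δ-ID : ∀ V A → All IsID (Δ V A)
  Δ-ID V A = anti-mono (sorted⊆ (falseAtoms V A)) (falseAtoms-ID V A)

  Δ-⊆-⇒ʳ : ∀ V A B → Δ V B ⊆ Δ V (A ⇒ B)
  Δ-⊆-⇒ʳ V A B =
    ⊆-trans (sorted⊆ (falseAtoms V B))
      (⊆-trans (xs⊆ys++xs (falseAtoms V B) (falseAtoms V A))
               (⊆sorted (falseAtoms V A ++ falseAtoms V B)))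

mainTheorem12 : (R : FormulaOrder) → (A B : Formula) → IsID A → IsID B →
    (V : Assignment) →
    let open WithOrder R in
    ((Δ V B ^⟨ B ⟩) ∷ []) ⊢id (Δ V (A ⇒ B) ^⟨ A ⇒ B ⟩)
mainTheorem12 R A B a b V =
  mp (hyp (here refl))
     (disjPrefix-mono (Δ-⊆-⇒ʳ V A B) (Δ-ID V (A ⇒ B)) b (impID a b) (ax1 b a))
  where
  open SortedSets R
  open DisjPrefix R
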